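{- For all integers $t\ge1$ and $0\le k\le t$, the randomized $[t,k]$-interval system $\mathcal F[t,k]$ produced by the algorithm SampleIntervalSystem$(t,k)$ is perfect, i.e. $\mathrm{Sets}(\mathcal F[t,k])$ is the uniform distribution over all $k$-element subsets of $[t]$.
   Context: An interval is a nonempty set $\{a,a+1,\dots,b\}$. A $[t,k]$-interval system is a set of $k$ pairwise disjoint intervals contained in $[t]$; a randomized $[t,k]$-interval system is a probability distribution over $[t,k]$-interval systems. For an interval system $F$, $\mathrm{Sets}(F)$ is the distribution of the set obtained by choosing, independently, one uniform element from each interval of $F$; for a randomized system $\mathcal F$, $\mathrm{Sets}(\mathcal F)$ samples $F\sim\mathcal F$ then a set from $\mathrm{Sets}(F)$. For an interval $I=[a,b]$ and integer $c$, $I+c=[a+c,b+c]$, and $F+c=\{I+c:I\in F\}$. SampleIntervalSystem$(t,k)$ (input $t\ge1$, $0\le k\le t$): if $k=0$ return $\emptyset$; if $k=1$ return $\{[t]\}$; otherwise let $s=\lceil t/2\rceil$, sample $j\in\{0,\dots,k\}$ with probability $\binom{s}{j}\binom{t-s}{k-j}/\binom tk$, compute $F_1=$ SampleIntervalSystem$(s,j)$ and $F_2=$ SampleIntervalSystem$(t-s,k-j)$ (independently), and return $F_1\cup(F_2+s)$. $\mathcal F[t,k]$ denotes the output distribution. -}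

module Defs where

open import Data.Nat as ℕ using (ℕ; zero; suc; _∸_; ⌈_/2⌉; _≡ᵇ_; _≤ᵇ_)
open import Data.Nat.Combinatorics using (_C_)
open import Data.Integer using (ℤ; +_)
open import Data.Rational using (ℚ; 0ℚ; 1ℚ; _/_; _+_; _*_)
open import Data.List using (List; []; _∷_; map; concatMap; _++_; foldr; upTo)
open import Data.Bool.ListAction using (any; all)
open import Data.Product using (_×_; _,_)
open import Data.Bool using (Bool; true; false; if_then_else_; _∧_)
open import Data.Fin using (Fin; toℕ)
open import Data.Fin.Subset using (Subset)
open import Data.Vec using (tabulate)
open import Data.Fin.Subset.Properties using ()
open import Relation.Nullary.Decidable using (⌊_⌋)
open import Data.Vec.Properties using (≡-dec)
open import Data.Bool.Properties using () renaming (_≟_ to _≟B_)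

-- Finitely supported (sub)probability distributions with rational weights:
-- a list of (weight, outcome) pairs; repeated outcomes add up.
Dist : Set → Set
Dist A = List (ℚ × A)

return : {A : Set} → A → Dist A
return x = (1ℚ , x) ∷ []

_>>=_ : {A B : Set} → Dist A → (A → Dist B) → Dist B
d >>= f = concatMap (λ { (p , x) → map (λ { (q , y) → (p * q , y) }) (f x) }) d

mass : {A : Set} → Dist A → ℚ
mass = foldr (λ { (p , _) acc → p + acc }) 0ℚ

Pr : {A : Set} → Dist A → (A → Bool) → ℚ
Pr d P = foldr (λ { (p , x) acc → if P x then p + acc else acc }) 0ℚ d

-- rational n/d, with the (never used) convention n/0 = 0
_/ℕ_ : ℤ → ℕ → ℚ
n /ℕ zero = 0ℚ
n /ℕ suc d = n / suc d

-- An interval {a,...,b} is represented by the pair (a , b); an interval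
-- system by the list of its intervals.
Interval : Set
Interval = ℕ × ℕ

IntervalSystem : Set
IntervalSystem = List Interval

shift : ℕ → IntervalSystem → IntervalSystem
shift c = map (λ { (a , b) → (a ℕ.+ c , b ℕ.+ c) })

uniformOn : Interval → Dist ℕ
uniformOn (a , b) = map (λ i → ((+ 1) / suc (b ∸ a) , a ℕ.+ i)) (upTo (suc (b ∸ a)))

SetsF : IntervalSystem → Dist (List ℕ)
SetsF [] = return []
SetsF (I ∷ F) = uniformOn I >>= λ x → SetsF F >>= λ xs → return (x ∷ xs)

Sets : Dist IntervalSystem → Dist (List ℕ)
Sets 𝓕 = 𝓕 >>= SetsF

-- SampleIntervalSystem(t,k), with a fuel argument to ensure termination.
-- On inputs 1 ≤ t, k ≤ t the fuel t always suffices (t ≥ 2 in the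
-- recursive case, and ⌈t/2⌉, t - ⌈t/2⌉ < t).
sampleGo : ℕ → ℕ → ℕ → Dist IntervalSystem
sampleGo fuel t zero = return []
sampleGo fuel t (suc zero) = return ((1 , t) ∷ [])
sampleGo zero t (suc (suc k')) = []
sampleGo (suc fuel) t (suc (suc k')) =
  pickJ >>= λ j →
  sampleGo fuel s j >>= λ F₁ →
  sampleGo fuel (t ∸ s) (k ∸ j) >>= λ F₂ →
  return (F₁ ++ shift s F₂)
  where
  k = suc (suc k')
  s = ⌈ t /2⌉
  pickJ : Dist ℕ
  pickJ = map (λ j → ((+ ((s C j) ℕ.* ((t ∸ s) C (k ∸ j)))) /ℕ (t C k) , j)) (upTo (suc k))

𝓕 : ℕ → ℕ → Dist IntervalSystem
𝓕 t k = sampleGo t t k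

-- The subset of [t] = {1,...,t} corresponding to S : Subset t
-- (position i : Fin t stands for the element i+1).
-- isSet t S xs : the set of elements of xs is exactly {i+1 : i ∈ S}.
isSet : (t : ℕ) → Subset t → List ℕ → Bool
isSet t S xs =
  all (λ x → (1 ≤ᵇ x) ∧ (x ≤ᵇ t)) xs ∧
  ⌊ ≡-dec _≟B_ (tabulate (λ i → any (λ x → suc (toℕ i) ≡ᵇ x) xs)) S ⌋

module Submission where

-- For every test function g, the expectation of g over Sets 𝓕[t,k] is shown to
-- be the mean of g over the k-subsets of {1,…,t}, by induction on t. In the
-- recursive step the two halves are independent, so by induction they are
-- uniform j- and (k − j)-subsets of {1,…,s} and {s+1,…,t}; the hypergeometric
-- weights C(s,j) C(t−s,k−j) / C(t,k) cancel these normalisations, and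
-- Vandermonde's identity, read summand by summand, reassembles the k-subsets
-- of {1,…,t}. Total mass and point probabilities are the cases g = 1 and
-- g = indicator of S.

open import Defs
open import Algebra.Bundles using (CommutativeMonoid)
open import Data.Bool using (Bool; true; false; if_then_else_; _∧_; _∨_; T)
open import Data.Bool.ListAction using (any; all)
open import Data.Bool.Properties using (T-≡) renaming (_≟_ to _≟B_)
open import Data.Fin using (Fin; toℕ; zero; suc)
open import Data.Fin.Subset using (Subset; ∣_∣; inside; outside; ⊥)
open import Data.Integer as ℤ using (+_)
open import Data.Integer.Solver renaming (module +-*-Solver to ℤ-Solver)
import Data.Integer.Properties as ℤ
open import Data.List using (List; []; _∷_; map; _++_; applyUpTo; upTo)
open import Data.Nat as ℕ
  using (ℕ; zero; suc; _≤_; _<_; _≡ᵇ_; _∸_; ⌈_/2⌉; ⌊_/2⌋; s≤s; z≤n; NonZero)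
import Data.Nat.Properties as ℕ
open import Data.Nat.Combinatorics
  using (_C_; nC1≡n; nCk+nC[k+1]≡[n+1]C[k+1]; k>n⇒nCk≡0)
open import Data.Product using (_×_; _,_; proj₁; proj₂)
open import Data.Rational using (ℚ; 0ℚ; 1ℚ; _/_; _+_; _*_; toℚᵘ)
open import Data.Rational.Properties
open import Data.Rational.Solver renaming (module +-*-Solver to ℚ-Solver)
open import Data.Rational.Unnormalised as ℚᵘ using (ℚᵘ; mkℚᵘ; *≡*) renaming (_≃_ to _≃ᵘ_)
import Data.Rational.Unnormalised.Properties as ℚᵘ
open import Data.Sum using (_⊎_; inj₁; inj₂)
open import Data.Vec using ([]; _∷_; lookup) renaming (_++_ to _++ᵥ_)
open import Data.Vec.Properties using (≡-dec; ∷-injectiveʳ; tabulate-cong; tabulate∘lookup)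
open import Function using (_∘_; id; const; Equivalence)
open import Relation.Binary.PropositionalEquality
open import Relation.Nullary.Decidable using (⌊_⌋; does; yes; no; dec-true; dec-false; isYes≗does)

open import Algebra.Properties.CommutativeSemigroup
  (CommutativeMonoid.commutativeSemigroup +-0-commutativeMonoid)
  using (interchange; x∙yz≈y∙xz)

open ≡-Reasoning

ι : ℕ → ℚ
ι n = + n / 1

-- ℚ is normalised, so identities between fractions are checked on
-- unnormalised representatives.
private
  toℚᵘ-/ : ∀ n d → toℚᵘ (+ n / suc d) ≃ᵘ mkℚᵘ (+ n) d
  toℚᵘ-/ n d = toℚᵘ-fromℚᵘ (mkℚᵘ (+ n) d)

  via-ℚᵘ : ∀ {p q : ℚ} (p′ q′ : ℚᵘ) → toℚᵘ p ≃ᵘ p′ → toℚᵘ q ≃ᵘ q′ → p′ ≃ᵘ q′ → p ≡ q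
  via-ℚᵘ _ _ p≃ q≃ p′≃q′ = toℚᵘ-injective (ℚᵘ.≃-trans p≃ (ℚᵘ.≃-trans p′≃q′ (ℚᵘ.≃-sym q≃)))

ι-+ : ∀ m n → ι (m ℕ.+ n) ≡ ι m + ι n
ι-+ m n = via-ℚᵘ (mkℚᵘ (+ (m ℕ.+ n)) 0) (mkℚᵘ (+ m) 0 ℚᵘ.+ mkℚᵘ (+ n) 0)
  (toℚᵘ-/ (m ℕ.+ n) 0)
  (ℚᵘ.≃-trans (toℚᵘ-homo-+ (ι m) (ι n)) (ℚᵘ.+-cong (toℚᵘ-/ m 0) (toℚᵘ-/ n 0)))
  (*≡* (trans (cong (ℤ._* + 1) (ℤ.pos-+ m n))
    (solve 2 (λ x y → (x :+ y) :* con (+ 1) := (x :* con (+ 1) :+ y :* con (+ 1)) :* con (+ 1))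
           refl (+ m) (+ n))))
  where open ℤ-Solver

ι-* : ∀ m n → ι (m ℕ.* n) ≡ ι m * ι n
ι-* m n = via-ℚᵘ (mkℚᵘ (+ (m ℕ.* n)) 0) (mkℚᵘ (+ m) 0 ℚᵘ.* mkℚᵘ (+ n) 0)
  (toℚᵘ-/ (m ℕ.* n) 0)
  (ℚᵘ.≃-trans (toℚᵘ-homo-* (ι m) (ι n)) (ℚᵘ.*-cong (toℚᵘ-/ m 0) (toℚᵘ-/ n 0)))
  (*≡* (cong (ℤ._* + 1) (ℤ.pos-* m n)))

n/d≡n*1/d : ∀ n d → + n / suc d ≡ ι n * (+ 1 / suc d)
n/d≡n*1/d n d = via-ℚᵘ (mkℚᵘ (+ n) d) (mkℚᵘ (+ n) 0 ℚᵘ.* mkℚᵘ (+ 1) d)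
  (toℚᵘ-/ n d)
  (ℚᵘ.≃-trans (toℚᵘ-homo-* (ι n) (+ 1 / suc d)) (ℚᵘ.*-cong (toℚᵘ-/ n 0) (toℚᵘ-/ 1 d)))
  (*≡* (trans (cong (λ e → + n ℤ.* + suc e) (ℕ.+-identityʳ d))
              (cong (ℤ._* + suc d) (sym (ℤ.*-identityʳ (+ n))))))

1/d*d≡1 : ∀ d → (+ 1 / suc d) * ι (suc d) ≡ 1ℚ
1/d*d≡1 d = via-ℚᵘ (mkℚᵘ (+ 1) d ℚᵘ.* mkℚᵘ (+ suc d) 0) (mkℚᵘ (+ 1) 0)
  (ℚᵘ.≃-trans (toℚᵘ-homo-* (+ 1 / suc d) (ι (suc d))) (ℚᵘ.*-cong (toℚᵘ-/ 1 d) (toℚᵘ-/ (suc d) 0)))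
  (*≡* refl)
  (*≡* (trans (ℤ.*-identityʳ (+ 1 ℤ.* + suc d))
              (cong (λ e → + 1 ℤ.* + suc e) (sym (ℕ.*-identityʳ d)))))

/ℕ-inverseˡ : ∀ c .{{_ : NonZero c}} → ((+ 1) /ℕ c) * ι c ≡ 1ℚ
/ℕ-inverseˡ (suc c) = 1/d*d≡1 c

0/ℕ≡0 : ∀ c → (+ 0) /ℕ c ≡ 0ℚ
0/ℕ≡0 zero    = refl
0/ℕ≡0 (suc c) = 0/n≡0 (suc c)

w≡0⇒w*x≡w*y : ∀ {w} x y → w ≡ 0ℚ → w * x ≡ w * y
w≡0⇒w*x≡w*y x y refl = trans (*-zeroˡ x) (sym (*-zeroˡ y))

private
  x*[y*[w*0]]≡v*0 : ∀ x y w v → x * (y * (w * 0ℚ)) ≡ v * 0ℚ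
  x*[y*[w*0]]≡v*0 = solve 4 (λ x y w v → x :* (y :* (w :* con 0ℚ)) := v :* con 0ℚ) refl
    where open ℚ-Solver

-- A hypergeometric weight against its two normalisations; this also holds when
-- some of a, b, c vanish, because x /ℕ 0 = 0.
/ℕ-cancel : ∀ a b c z → (a ≡ 0 → z ≡ 0ℚ) → (b ≡ 0 → z ≡ 0ℚ) →
  ((+ (a ℕ.* b)) /ℕ c) * (((+ 1) /ℕ a) * (((+ 1) /ℕ b) * z)) ≡ ((+ 1) /ℕ c) * z
/ℕ-cancel a b zero z _ _ =
  trans (*-zeroˡ (((+ 1) /ℕ a) * (((+ 1) /ℕ b) * z))) (sym (*-zeroˡ z))
/ℕ-cancel zero b (suc c) z a≡0⇒z≡0 _ rewrite a≡0⇒z≡0 refl =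
  x*[y*[w*0]]≡v*0 ((+ 0) / suc c) 0ℚ ((+ 1) /ℕ b) ((+ 1) / suc c)
/ℕ-cancel (suc a) zero (suc c) z _ b≡0⇒z≡0 rewrite b≡0⇒z≡0 refl =
  x*[y*[w*0]]≡v*0 ((+ (suc a ℕ.* 0)) / suc c) ((+ 1) / suc a) 0ℚ ((+ 1) / suc c)
/ℕ-cancel (suc a) (suc b) (suc c) z _ _ = begin
  (+ (suc a ℕ.* suc b) / suc c) * ((+ 1 / suc a) * ((+ 1 / suc b) * z))
    ≡⟨ cong (_* _) (trans (n/d≡n*1/d (suc a ℕ.* suc b) c) (cong (_* _) (ι-* (suc a) (suc b)))) ⟩
  ((ι (suc a) * ι (suc b)) * 1/c) * (1/a * (1/b * z))
    ≡⟨ solve 6 (λ x y w v q r → ((x :* y) :* w) :* (v :* (q :* r)) := ((v :* x) :* (q :* y)) :* (w :* r))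
             refl (ι (suc a)) (ι (suc b)) 1/c 1/a 1/b z ⟩
  ((1/a * ι (suc a)) * (1/b * ι (suc b))) * (1/c * z)
    ≡⟨ cong₂ (λ x y → (x * y) * (1/c * z)) (1/d*d≡1 a) (1/d*d≡1 b) ⟩
  (1ℚ * 1ℚ) * (1/c * z)
    ≡⟨ *-identityˡ (1/c * z) ⟩
  1/c * z ∎
  where
  open ℚ-Solver
  1/a = + 1 / suc a
  1/b = + 1 / suc b
  1/c = + 1 / suc c

𝟙 : Bool → ℚ
𝟙 b = if b then 1ℚ else 0ℚ

*-𝟙 : ∀ x b → x * 𝟙 b ≡ (if b then x else 0ℚ)
*-𝟙 x true  = *-identityʳ x
*-𝟙 x false = *-zeroʳ x

sumUpTo : ℕ → (ℕ → ℚ) → ℚ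
sumUpTo zero    f = 0ℚ
sumUpTo (suc n) f = f 0 + sumUpTo n (f ∘ suc)

sumUpTo-cong : ∀ n {f g : ℕ → ℚ} → (∀ i → f i ≡ g i) → sumUpTo n f ≡ sumUpTo n g
sumUpTo-cong zero    f≗g = refl
sumUpTo-cong (suc n) f≗g = cong₂ _+_ (f≗g 0) (sumUpTo-cong n (f≗g ∘ suc))

sumUpTo-zero : ∀ n → sumUpTo n (const 0ℚ) ≡ 0ℚ
sumUpTo-zero zero    = refl
sumUpTo-zero (suc n) = trans (+-identityˡ _) (sumUpTo-zero n)

sumUpTo-+ : ∀ n (f g : ℕ → ℚ) → sumUpTo n (λ i → f i + g i) ≡ sumUpTo n f + sumUpTo n g
sumUpTo-+ zero    f g = refl
sumUpTo-+ (suc n) f g =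
  trans (cong (_+_ (f 0 + g 0)) (sumUpTo-+ n (f ∘ suc) (g ∘ suc))) (interchange (f 0) (g 0) _ _)

sumUpTo-* : ∀ n c (f : ℕ → ℚ) → sumUpTo n (λ i → c * f i) ≡ c * sumUpTo n f
sumUpTo-* zero    c f = sym (*-zeroʳ c)
sumUpTo-* (suc n) c f = trans (cong (_+_ (c * f 0)) (sumUpTo-* n c (f ∘ suc))) (sym (*-distribˡ-+ c _ _))

E : {A : Set} → Dist A → (A → ℚ) → ℚ
E []            g = 0ℚ
E ((p , x) ∷ d) g = p * g x + E d g

mass≡E : {A : Set} (d : Dist A) → mass d ≡ E d (const 1ℚ)
mass≡E []            = refl
mass≡E ((p , x) ∷ d) = cong₂ _+_ (sym (*-identityʳ p)) (mass≡E d)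

Pr≡E : {A : Set} (d : Dist A) (P : A → Bool) → Pr d P ≡ E d (𝟙 ∘ P)
Pr≡E []            P = refl
Pr≡E ((p , x) ∷ d) P with P x
... | true  = cong₂ _+_ (sym (*-identityʳ p)) (Pr≡E d P)
... | false = trans (Pr≡E d P) (sym (trans (cong (_+ E d (𝟙 ∘ P)) (*-zeroʳ p)) (+-identityˡ _)))

E-cong : {A : Set} (d : Dist A) {g h : A → ℚ} → (∀ x → g x ≡ h x) → E d g ≡ E d h
E-cong []            g≗h = refl
E-cong ((p , x) ∷ d) g≗h = cong₂ _+_ (cong (p *_) (g≗h x)) (E-cong d g≗h)

E-++ : {A : Set} (d d′ : Dist A) (g : A → ℚ) → E (d ++ d′) g ≡ E d g + E d′ g
E-++ []            d′ g = sym (+-identityˡ _)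
E-++ ((p , x) ∷ d) d′ g = trans (cong (_+_ (p * g x)) (E-++ d d′ g)) (sym (+-assoc (p * g x) _ _))

E-+ : {A : Set} (d : Dist A) (g h : A → ℚ) → E d (λ x → g x + h x) ≡ E d g + E d h
E-+ []            g h = refl
E-+ ((p , x) ∷ d) g h =
  trans (cong₂ _+_ (*-distribˡ-+ p (g x) (h x)) (E-+ d g h)) (interchange (p * g x) (p * h x) _ _)

E-* : {A : Set} (d : Dist A) (c : ℚ) (g : A → ℚ) → E d (λ x → c * g x) ≡ c * E d g
E-* []            c g = sym (*-zeroʳ c)
E-* ((p , x) ∷ d) c g =
  trans (cong₂ _+_ p*[c*gx]≡c*[p*gx] (E-* d c g)) (sym (*-distribˡ-+ c _ _))
  where
  p*[c*gx]≡c*[p*gx] : p * (c * g x) ≡ c * (p * g x)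
  p*[c*gx]≡c*[p*gx] = trans (sym (*-assoc p c (g x))) (trans (cong (_* g x) (*-comm p c)) (*-assoc c p (g x)))

E-zero : {A : Set} (d : Dist A) → E d (const 0ℚ) ≡ 0ℚ
E-zero []            = refl
E-zero ((p , x) ∷ d) = trans (cong₂ _+_ (*-zeroʳ p) (E-zero d)) (+-identityˡ 0ℚ)

E-swap : {A B : Set} (d : Dist A) (d′ : Dist B) (h : A → B → ℚ) →
  E d (λ x → E d′ (h x)) ≡ E d′ (λ y → E d (λ x → h x y))
E-swap []            d′ h = sym (E-zero d′)
E-swap ((p , x) ∷ d) d′ h =
  trans (cong₂ _+_ (sym (E-* d′ p (h x))) (E-swap d d′ h)) (sym (E-+ d′ _ _))

E-return : {A : Set} (x : A) (g : A → ℚ) → E (return x) g ≡ g x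
E-return x g = trans (+-identityʳ _) (*-identityˡ (g x))

E-bind : {A B : Set} (d : Dist A) (f : A → Dist B) (g : B → ℚ) →
  E (d >>= f) g ≡ E d (λ x → E (f x) g)
E-bind []            f g = refl
E-bind ((p , x) ∷ d) f g =
  trans (E-++ (map _ (f x)) (d >>= f) g) (cong₂ _+_ (E-scaled (f x)) (E-bind d f g))
  where
  E-scaled : ∀ d′ → E (map (λ { (q , y) → (p * q , y) }) d′) g ≡ p * E d′ g
  E-scaled []            = sym (*-zeroʳ p)
  E-scaled ((q , y) ∷ d′) = trans (cong₂ _+_ (*-assoc p q (g y)) (E-scaled d′)) (sym (*-distribˡ-+ p _ _))

E-map-applyUpTo : {A : Set} (m : ℕ → ℚ × A) (h : ℕ → ℕ) (n : ℕ) (g : A → ℚ) →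
  E (map m (applyUpTo h n)) g ≡ sumUpTo n (λ i → proj₁ (m (h i)) * g (proj₂ (m (h i))))
E-map-applyUpTo m h zero    g = refl
E-map-applyUpTo m h (suc n) g =
  cong (_+_ (proj₁ (m (h 0)) * g (proj₂ (m (h 0))))) (E-map-applyUpTo m (h ∘ suc) n g)

-- Sums over the k-subsets of a finite set

sumSubsets : (n k : ℕ) → (Subset n → ℚ) → ℚ
sumSubsets zero    zero    f = f []
sumSubsets zero    (suc k) f = 0ℚ
sumSubsets (suc n) zero    f = sumSubsets n zero (f ∘ (outside ∷_))
sumSubsets (suc n) (suc k) f = sumSubsets n k (f ∘ (inside ∷_)) + sumSubsets n (suc k) (f ∘ (outside ∷_))

sumSubsets-cong : ∀ n k {f g : Subset n → ℚ} → (∀ S → f S ≡ g S) → sumSubsets n k f ≡ sumSubsets n k g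
sumSubsets-cong zero    zero    f≗g = f≗g []
sumSubsets-cong zero    (suc k) f≗g = refl
sumSubsets-cong (suc n) zero    f≗g = sumSubsets-cong n zero (f≗g ∘ (outside ∷_))
sumSubsets-cong (suc n) (suc k) f≗g =
  cong₂ _+_ (sumSubsets-cong n k (f≗g ∘ (inside ∷_))) (sumSubsets-cong n (suc k) (f≗g ∘ (outside ∷_)))

sumSubsets-* : ∀ n k c (f : Subset n → ℚ) → sumSubsets n k (λ S → c * f S) ≡ c * sumSubsets n k f
sumSubsets-* zero    zero    c f = refl
sumSubsets-* zero    (suc k) c f = sym (*-zeroʳ c)
sumSubsets-* (suc n) zero    c f = sumSubsets-* n zero c (f ∘ (outside ∷_))
sumSubsets-* (suc n) (suc k) c f =
  trans (cong₂ _+_ (sumSubsets-* n k c (f ∘ (inside ∷_))) (sumSubsets-* n (suc k) c (f ∘ (outside ∷_))))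
        (sym (*-distribˡ-+ c _ _))

sumSubsets-zero : ∀ n k {f : Subset n → ℚ} → (∀ S → f S ≡ 0ℚ) → sumSubsets n k f ≡ 0ℚ
sumSubsets-zero n k f≗0 = trans (sumSubsets-cong n k f≗0)
  (trans (sumSubsets-* n k 0ℚ (const 0ℚ)) (*-zeroˡ (sumSubsets n k (const 0ℚ))))

sumSubsets-vanish : ∀ n k {f : Subset n → ℚ} → n C k ≡ 0 → sumSubsets n k f ≡ 0ℚ
sumSubsets-vanish zero    (suc k) _   = refl
sumSubsets-vanish (suc n) (suc k) C≡0 =
  trans (cong₂ _+_ (sumSubsets-vanish n k (ℕ.m+n≡0⇒m≡0 _ pascal))
                   (sumSubsets-vanish n (suc k) (ℕ.m+n≡0⇒n≡0 _ pascal)))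
        (+-identityˡ 0ℚ)
  where pascal = trans (nCk+nC[k+1]≡[n+1]C[k+1] n k) C≡0

sumSubsets-const-1 : ∀ n k → sumSubsets n k (const 1ℚ) ≡ ι (n C k)
sumSubsets-const-1 zero    zero    = refl
sumSubsets-const-1 zero    (suc k) = refl
sumSubsets-const-1 (suc n) zero    = sumSubsets-const-1 n zero
sumSubsets-const-1 (suc n) (suc k) =
  trans (cong₂ _+_ (sumSubsets-const-1 n k) (sumSubsets-const-1 n (suc k)))
        (trans (sym (ι-+ (n C k) (n C suc k))) (cong ι (nCk+nC[k+1]≡[n+1]C[k+1] n k)))

sumSubsets-⊥ : ∀ n (f : Subset n → ℚ) → sumSubsets n 0 f ≡ f ⊥
sumSubsets-⊥ zero    f = refl
sumSubsets-⊥ (suc n) f = sumSubsets-⊥ n (f ∘ (outside ∷_))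

sumSubsets-point : ∀ n k (S : Subset n) (f : Subset n → ℚ) → (∀ S′ → S′ ≢ S → f S′ ≡ 0ℚ) →
  sumSubsets n k f ≡ (if ∣ S ∣ ≡ᵇ k then f S else 0ℚ)
sumSubsets-point zero    zero    []            f _   = refl
sumSubsets-point zero    (suc k) []            f _   = refl
sumSubsets-point (suc n) zero    (inside ∷ S)  f f≗0 =
  sumSubsets-zero n zero (λ S′ → f≗0 _ (λ ()))
sumSubsets-point (suc n) zero    (outside ∷ S) f f≗0 =
  sumSubsets-point n zero S (f ∘ (outside ∷_)) (λ S′ S′≢S → f≗0 _ (S′≢S ∘ ∷-injectiveʳ))
sumSubsets-point (suc n) (suc k) (inside ∷ S)  f f≗0 =
  trans (cong₂ _+_ (sumSubsets-point n k S (f ∘ (inside ∷_)) (λ S′ S′≢S → f≗0 _ (S′≢S ∘ ∷-injectiveʳ)))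
                   (sumSubsets-zero n (suc k) (λ S′ → f≗0 _ (λ ()))))
        (+-identityʳ _)
sumSubsets-point (suc n) (suc k) (outside ∷ S) f f≗0 =
  trans (cong₂ _+_ (sumSubsets-zero n k (λ S′ → f≗0 _ (λ ())))
                   (sumSubsets-point n (suc k) S (f ∘ (outside ∷_)) (λ S′ S′≢S → f≗0 _ (S′≢S ∘ ∷-injectiveʳ))))
        (+-identityˡ _)

-- Vandermonde's identity, summand by summand: a k-subset of [s + r] splits
-- into a j-subset of [s] and a (k − j)-subset of [r].
sumSubsets-++ : ∀ s r k (F : Subset (s ℕ.+ r) → ℚ) →
  sumUpTo (suc k) (λ j → sumSubsets s j (λ S₁ → sumSubsets r (k ∸ j) (λ S₂ → F (S₁ ++ᵥ S₂))))
  ≡ sumSubsets (s ℕ.+ r) k F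
sumSubsets-++ zero    r k       F = trans (cong (_+_ (sumSubsets r k F)) (sumUpTo-zero k)) (+-identityʳ _)
sumSubsets-++ (suc s) r zero    F = sumSubsets-++ s r zero (F ∘ (outside ∷_))
sumSubsets-++ (suc s) r (suc k) F = begin
  O 0 + sumUpTo (suc k) (λ j → I j + O (suc j))
    ≡⟨ cong (_+_ (O 0)) (sumUpTo-+ (suc k) I (O ∘ suc)) ⟩
  O 0 + (sumUpTo (suc k) I + sumUpTo (suc k) (O ∘ suc))
    ≡⟨ x∙yz≈y∙xz (O 0) (sumUpTo (suc k) I) (sumUpTo (suc k) (O ∘ suc)) ⟩
  sumUpTo (suc k) I + sumUpTo (suc (suc k)) O
    ≡⟨ cong₂ _+_ (sumSubsets-++ s r k (F ∘ (inside ∷_))) (sumSubsets-++ s r (suc k) (F ∘ (outside ∷_))) ⟩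
  sumSubsets (suc s ℕ.+ r) (suc k) F ∎
  where
  I O : ℕ → ℚ
  I j = sumSubsets s j (λ S₁ → sumSubsets r (k ∸ j) (λ S₂ → F (inside ∷ (S₁ ++ᵥ S₂))))
  O j = sumSubsets s j (λ S₁ → sumSubsets r (suc k ∸ j) (λ S₂ → F (outside ∷ (S₁ ++ᵥ S₂))))

-- Subsets of {1,…,n} as lists

-- elementsFrom o S lists the numbers o + i + 1 for the positions i ∈ S in
-- increasing order, so elements S is the subset of {1,…,n} that S encodes in isSet.
elementsFrom : ℕ → {n : ℕ} → Subset n → List ℕ
elementsFrom o []            = []
elementsFrom o (inside ∷ S)  = suc o ∷ elementsFrom (suc o) S
elementsFrom o (outside ∷ S) = elementsFrom (suc o) S

elements : {n : ℕ} → Subset n → List ℕ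
elements = elementsFrom 0

map-+-elementsFrom : ∀ o s {n} (S : Subset n) → map (ℕ._+ s) (elementsFrom o S) ≡ elementsFrom (o ℕ.+ s) S
map-+-elementsFrom o s []            = refl
map-+-elementsFrom o s (inside ∷ S)  = cong (suc (o ℕ.+ s) ∷_) (map-+-elementsFrom (suc o) s S)
map-+-elementsFrom o s (outside ∷ S) = map-+-elementsFrom (suc o) s S

elementsFrom-++ : ∀ o {s r} (S₁ : Subset s) (S₂ : Subset r) →
  elementsFrom o (S₁ ++ᵥ S₂) ≡ elementsFrom o S₁ ++ elementsFrom (o ℕ.+ s) S₂
elementsFrom-++ o []  S₂ = cong (λ o′ → elementsFrom o′ S₂) (sym (ℕ.+-identityʳ o))
elementsFrom-++ o {suc s} (b ∷ S₁) S₂ rewrite ℕ.+-suc o s with b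
... | inside  = cong (suc o ∷_) (elementsFrom-++ (suc o) S₁ S₂)
... | outside = elementsFrom-++ (suc o) S₁ S₂

elements-++ : ∀ {s r} (S₁ : Subset s) (S₂ : Subset r) →
  elements (S₁ ++ᵥ S₂) ≡ elements S₁ ++ map (ℕ._+ s) (elements S₂)
elements-++ S₁ S₂ = trans (elementsFrom-++ 0 S₁ S₂) (cong (elements S₁ ++_) (sym (map-+-elementsFrom 0 _ S₂)))

elementsFrom-⊥ : ∀ o n → elementsFrom o (⊥ {n}) ≡ []
elementsFrom-⊥ o zero    = refl
elementsFrom-⊥ o (suc n) = elementsFrom-⊥ (suc o) n

sumSubsets-singletons : ∀ n o (g : List ℕ → ℚ) →
  sumSubsets n 1 (g ∘ elementsFrom o) ≡ sumUpTo n (λ i → g (suc (o ℕ.+ i) ∷ []))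
sumSubsets-singletons zero    o g = refl
sumSubsets-singletons (suc n) o g = cong₂ _+_
  (trans (sumSubsets-⊥ n _)
         (cong₂ (λ x xs → g (x ∷ xs)) (cong suc (sym (ℕ.+-identityʳ o))) (elementsFrom-⊥ (suc o) n)))
  (trans (sumSubsets-singletons n (suc o) g)
         (sumUpTo-cong n (λ i → cong (λ x → g (suc x ∷ [])) (sym (ℕ.+-suc o i)))))

≡ᵇ-refl : ∀ n → (n ≡ᵇ n) ≡ true
≡ᵇ-refl n = dec-true (n ℕ.≟ n) refl

≢⇒≡ᵇ-false : ∀ {m n} → m ≢ n → (m ≡ᵇ n) ≡ false
≢⇒≡ᵇ-false {m} {n} = dec-false (m ℕ.≟ n)

private
  ≤-+-suc : ∀ {x} o n → x ≤ suc o ℕ.+ n → x ≤ o ℕ.+ suc n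
  ≤-+-suc {x} o n = subst (x ≤_) (sym (ℕ.+-suc o n))

all-elementsFrom : ∀ (p : ℕ → Bool) o {n} (S : Subset n) →
  (∀ x → o < x → x ≤ o ℕ.+ n → p x ≡ true) → all p (elementsFrom o S) ≡ true
all-elementsFrom p o []                    p-in-range = refl
all-elementsFrom p o {suc n} (inside ∷ S)  p-in-range =
  cong₂ _∧_ (p-in-range (suc o) ℕ.≤-refl (≤-+-suc o n (ℕ.m≤m+n (suc o) n)))
            (all-elementsFrom p (suc o) S (λ x o<x x≤ → p-in-range x (ℕ.<⇒≤ o<x) (≤-+-suc o n x≤)))
all-elementsFrom p o {suc n} (outside ∷ S) p-in-range =
  all-elementsFrom p (suc o) S (λ x o<x x≤ → p-in-range x (ℕ.<⇒≤ o<x) (≤-+-suc o n x≤))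

any-elementsFrom-≤ : ∀ {y} o {n} (S : Subset n) → y ≤ o → any (y ≡ᵇ_) (elementsFrom o S) ≡ false
any-elementsFrom-≤ o []            y≤o = refl
any-elementsFrom-≤ o (inside ∷ S)  y≤o =
  cong₂ _∨_ (≢⇒≡ᵇ-false (ℕ.<⇒≢ (s≤s y≤o))) (any-elementsFrom-≤ (suc o) S (ℕ.m≤n⇒m≤1+n y≤o))
any-elementsFrom-≤ o (outside ∷ S) y≤o = any-elementsFrom-≤ (suc o) S (ℕ.m≤n⇒m≤1+n y≤o)

any-elementsFrom : ∀ o {n} (S : Subset n) (i : Fin n) →
  any (suc (o ℕ.+ toℕ i) ≡ᵇ_) (elementsFrom o S) ≡ lookup S i
any-elementsFrom o (inside ∷ S)  zero rewrite ℕ.+-identityʳ o =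
  cong (_∨ any (suc o ≡ᵇ_) (elementsFrom (suc o) S)) (≡ᵇ-refl o)
any-elementsFrom o (outside ∷ S) zero rewrite ℕ.+-identityʳ o = any-elementsFrom-≤ (suc o) S ℕ.≤-refl
any-elementsFrom o (inside ∷ S)  (suc i) rewrite ℕ.+-suc o (toℕ i) =
  cong₂ _∨_ (≢⇒≡ᵇ-false (ℕ.>⇒≢ (s≤s (ℕ.m≤m+n o (toℕ i))))) (any-elementsFrom (suc o) S i)
any-elementsFrom o (outside ∷ S) (suc i) rewrite ℕ.+-suc o (toℕ i) = any-elementsFrom (suc o) S i

isSet-elements : ∀ t (S S′ : Subset t) → isSet t S (elements S′) ≡ ⌊ ≡-dec _≟B_ S′ S ⌋
isSet-elements t S S′ = cong₂ _∧_
  (all-elementsFrom _ 0 S′ (λ x 0<x x≤t → cong₂ _∧_ (T⇒≡true (ℕ.≤⇒≤ᵇ 0<x)) (T⇒≡true (ℕ.≤⇒≤ᵇ x≤t))))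
  (cong (λ S″ → ⌊ ≡-dec _≟B_ S″ S ⌋)
        (trans (tabulate-cong (any-elementsFrom 0 S′)) (tabulate∘lookup S′)))
  where
  T⇒≡true : ∀ {b} → T b → b ≡ true
  T⇒≡true = Equivalence.to T-≡

sumSubsets-isSet : ∀ t k (S : Subset t) → sumSubsets t k (𝟙 ∘ isSet t S ∘ elements) ≡ 𝟙 (∣ S ∣ ≡ᵇ k)
sumSubsets-isSet t k S =
  trans (sumSubsets-point t k S (𝟙 ∘ isSet t S ∘ elements) vanishes-off-S)
        (cong (λ v → if ∣ S ∣ ≡ᵇ k then v else 0ℚ) (cong 𝟙 holds-at-S))
  where
  isSet-elements′ : ∀ S′ → isSet t S (elements S′) ≡ does (≡-dec _≟B_ S′ S)
  isSet-elements′ S′ = trans (isSet-elements t S S′) (isYes≗does (≡-dec _≟B_ S′ S))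
  vanishes-off-S : ∀ S′ → S′ ≢ S → 𝟙 (isSet t S (elements S′)) ≡ 0ℚ
  vanishes-off-S S′ S′≢S = cong 𝟙 (trans (isSet-elements′ S′) (dec-false (≡-dec _≟B_ S′ S) S′≢S))
  holds-at-S : isSet t S (elements S) ≡ true
  holds-at-S = trans (isSet-elements′ S) (dec-true (≡-dec _≟B_ S S) refl)

-- Sets of interval systems

E-Sets-return : ∀ F (g : List ℕ → ℚ) → E (Sets (return F)) g ≡ E (SetsF F) g
E-Sets-return F g = trans (E-bind (return F) SetsF g) (E-return F (λ F′ → E (SetsF F′) g))

E-uniformOn : ∀ a b (g : ℕ → ℚ) →
  E (uniformOn (a , b)) g ≡ sumUpTo (suc (b ∸ a)) (λ i → ((+ 1) / suc (b ∸ a)) * g (a ℕ.+ i))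
E-uniformOn a b g = E-map-applyUpTo (λ i → ((+ 1) / suc (b ∸ a) , a ℕ.+ i)) id (suc (b ∸ a)) g

E-uniformOn-shift : ∀ a b s (g : ℕ → ℚ) →
  E (uniformOn (a ℕ.+ s , b ℕ.+ s)) g ≡ E (uniformOn (a , b)) (g ∘ (ℕ._+ s))
E-uniformOn-shift a b s g =
  trans (E-uniformOn (a ℕ.+ s) (b ℕ.+ s) g) (trans shifted (sym (E-uniformOn a b (g ∘ (ℕ._+ s)))))
  where
  length-invariant : (b ℕ.+ s) ∸ (a ℕ.+ s) ≡ b ∸ a
  length-invariant rewrite ℕ.+-comm b s | ℕ.+-comm a s = ℕ.[m+n]∸[m+o]≡n∸o s b a
  shifted : sumUpTo (suc ((b ℕ.+ s) ∸ (a ℕ.+ s))) (λ i → ((+ 1) / suc ((b ℕ.+ s) ∸ (a ℕ.+ s))) * g (a ℕ.+ s ℕ.+ i))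
          ≡ sumUpTo (suc (b ∸ a)) (λ i → ((+ 1) / suc (b ∸ a)) * g (a ℕ.+ i ℕ.+ s))
  shifted rewrite length-invariant =
    sumUpTo-cong (suc (b ∸ a)) (λ i → cong (λ x → ((+ 1) / suc (b ∸ a)) * g x)
      (trans (ℕ.+-assoc a s i) (trans (cong (a ℕ.+_) (ℕ.+-comm s i)) (sym (ℕ.+-assoc a i s)))))

E-SetsF-∷ : ∀ I F (g : List ℕ → ℚ) →
  E (SetsF (I ∷ F)) g ≡ E (uniformOn I) (λ x → E (SetsF F) (g ∘ (x ∷_)))
E-SetsF-∷ I F g =
  trans (E-bind (uniformOn I) (λ x → SetsF F >>= λ xs → return (x ∷ xs)) g) (E-cong (uniformOn I) (λ x →
    trans (E-bind (SetsF F) (λ xs → return (x ∷ xs)) g) (E-cong (SetsF F) (λ xs → E-return (x ∷ xs) g))))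

E-SetsF-++ : ∀ F₁ F₂ (g : List ℕ → ℚ) →
  E (SetsF (F₁ ++ F₂)) g ≡ E (SetsF F₁) (λ xs → E (SetsF F₂) (g ∘ (xs ++_)))
E-SetsF-++ []       F₂ g = sym (E-return [] (λ xs → E (SetsF F₂) (g ∘ (xs ++_))))
E-SetsF-++ (I ∷ F₁) F₂ g = begin
  E (SetsF (I ∷ F₁ ++ F₂)) g
    ≡⟨ E-SetsF-∷ I (F₁ ++ F₂) g ⟩
  E (uniformOn I) (λ x → E (SetsF (F₁ ++ F₂)) (g ∘ (x ∷_)))
    ≡⟨ E-cong (uniformOn I) (λ x → E-SetsF-++ F₁ F₂ (g ∘ (x ∷_))) ⟩
  E (uniformOn I) (λ x → E (SetsF F₁) (λ xs → E (SetsF F₂) (g ∘ ((x ∷ xs) ++_))))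
    ≡⟨ E-SetsF-∷ I F₁ (λ xs → E (SetsF F₂) (g ∘ (xs ++_))) ⟨
  E (SetsF (I ∷ F₁)) (λ xs → E (SetsF F₂) (g ∘ (xs ++_))) ∎

E-SetsF-shift : ∀ s F (g : List ℕ → ℚ) → E (SetsF (shift s F)) g ≡ E (SetsF F) (g ∘ map (ℕ._+ s))
E-SetsF-shift s []            g = refl
E-SetsF-shift s ((a , b) ∷ F) g = begin
  E (SetsF (shift s ((a , b) ∷ F))) g
    ≡⟨ E-SetsF-∷ (a ℕ.+ s , b ℕ.+ s) (shift s F) g ⟩
  E (uniformOn (a ℕ.+ s , b ℕ.+ s)) (λ x → E (SetsF (shift s F)) (g ∘ (x ∷_)))
    ≡⟨ E-uniformOn-shift a b s _ ⟩
  E (uniformOn (a , b)) (λ x → E (SetsF (shift s F)) (g ∘ (x ℕ.+ s ∷_)))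
    ≡⟨ E-cong (uniformOn (a , b)) (λ x → E-SetsF-shift s F (g ∘ (x ℕ.+ s ∷_))) ⟩
  E (uniformOn (a , b)) (λ x → E (SetsF F) (g ∘ map (ℕ._+ s) ∘ (x ∷_)))
    ≡⟨ E-SetsF-∷ (a , b) F (g ∘ map (ℕ._+ s)) ⟨
  E (SetsF ((a , b) ∷ F)) (g ∘ map (ℕ._+ s)) ∎

E-Sets-juxtapose : ∀ (𝓕₁ 𝓕₂ : Dist IntervalSystem) s (g : List ℕ → ℚ) →
  E (Sets (𝓕₁ >>= λ F₁ → 𝓕₂ >>= λ F₂ → return (F₁ ++ shift s F₂))) g
  ≡ E (Sets 𝓕₁) (λ xs → E (Sets 𝓕₂) (λ ys → g (xs ++ map (ℕ._+ s) ys)))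
E-Sets-juxtapose 𝓕₁ 𝓕₂ s g = begin
  E (Sets (𝓕₁ >>= λ F₁ → 𝓕₂ >>= λ F₂ → return (F₁ ++ shift s F₂))) g
    ≡⟨ E-bind (𝓕₁ >>= λ F₁ → 𝓕₂ >>= λ F₂ → return (F₁ ++ shift s F₂)) SetsF g ⟩
  E (𝓕₁ >>= λ F₁ → 𝓕₂ >>= λ F₂ → return (F₁ ++ shift s F₂)) Φ
    ≡⟨ E-bind 𝓕₁ (λ F₁ → 𝓕₂ >>= λ F₂ → return (F₁ ++ shift s F₂)) Φ ⟩
  E 𝓕₁ (λ F₁ → E (𝓕₂ >>= λ F₂ → return (F₁ ++ shift s F₂)) Φ)
    ≡⟨ E-cong 𝓕₁ (λ F₁ → trans (E-bind 𝓕₂ (λ F₂ → return (F₁ ++ shift s F₂)) Φ)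
                                 (E-cong 𝓕₂ (λ F₂ → E-return (F₁ ++ shift s F₂) Φ))) ⟩
  E 𝓕₁ (λ F₁ → E 𝓕₂ (λ F₂ → Φ (F₁ ++ shift s F₂)))
    ≡⟨ E-cong 𝓕₁ (λ F₁ → E-cong 𝓕₂ (λ F₂ → trans (E-SetsF-++ F₁ (shift s F₂) g)
         (E-cong (SetsF F₁) (λ xs → E-SetsF-shift s F₂ (g ∘ (xs ++_)))))) ⟩
  E 𝓕₁ (λ F₁ → E 𝓕₂ (λ F₂ → E (SetsF F₁) (λ xs → E (SetsF F₂) (G xs))))
    ≡⟨ E-cong 𝓕₁ (λ F₁ → E-swap 𝓕₂ (SetsF F₁) (λ F₂ xs → E (SetsF F₂) (G xs))) ⟩
  E 𝓕₁ (λ F₁ → E (SetsF F₁) (λ xs → E 𝓕₂ (λ F₂ → E (SetsF F₂) (G xs))))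
    ≡⟨ E-bind 𝓕₁ SetsF (λ xs → E 𝓕₂ (λ F₂ → E (SetsF F₂) (G xs))) ⟨
  E (Sets 𝓕₁) (λ xs → E 𝓕₂ (λ F₂ → E (SetsF F₂) (G xs)))
    ≡⟨ E-cong (Sets 𝓕₁) (λ xs → E-bind 𝓕₂ SetsF (G xs)) ⟨
  E (Sets 𝓕₁) (λ xs → E (Sets 𝓕₂) (G xs)) ∎
  where
  Φ : IntervalSystem → ℚ
  Φ F = E (SetsF F) g
  G : List ℕ → List ℕ → ℚ
  G xs ys = g (xs ++ map (ℕ._+ s) ys)

meanOverSubsets : (t k : ℕ) → (List ℕ → ℚ) → ℚ
meanOverSubsets t k g = ((+ 1) /ℕ (t C k)) * sumSubsets t k (g ∘ elements)

hypergeometric : (s r t k j : ℕ) → ℚ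
hypergeometric s r t k j = (+ ((s C j) ℕ.* (r C (k ∸ j)))) /ℕ (t C k)

meanOverSubsets-split : ∀ s r t k → s ℕ.+ r ≡ t → ∀ (g : List ℕ → ℚ) →
  sumUpTo (suc k) (λ j → hypergeometric s r t k j
    * meanOverSubsets s j (λ xs → meanOverSubsets r (k ∸ j) (λ ys → g (xs ++ map (ℕ._+ s) ys))))
  ≡ meanOverSubsets t k g
meanOverSubsets-split s r .(s ℕ.+ r) k refl g = begin
  sumUpTo (suc k) (λ j → hypergeometric s r (s ℕ.+ r) k j * meanOverSubsets s j (M j))
    ≡⟨ sumUpTo-cong (suc k) cancel ⟩
  sumUpTo (suc k) (λ j → 1/C * Z j)
    ≡⟨ sumUpTo-* (suc k) 1/C Z ⟩
  1/C * sumUpTo (suc k) Z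
    ≡⟨ cong (1/C *_) (sumSubsets-++ s r k (g ∘ elements)) ⟩
  meanOverSubsets (s ℕ.+ r) k g ∎
  where
  1/C = (+ 1) /ℕ ((s ℕ.+ r) C k)
  M : ℕ → List ℕ → ℚ
  M j xs = meanOverSubsets r (k ∸ j) (λ ys → g (xs ++ map (ℕ._+ s) ys))
  Z : ℕ → ℚ
  Z j = sumSubsets s j (λ S₁ → sumSubsets r (k ∸ j) (λ S₂ → g (elements (S₁ ++ᵥ S₂))))
  factor : ∀ j → meanOverSubsets s j (M j) ≡ ((+ 1) /ℕ (s C j)) * (((+ 1) /ℕ (r C (k ∸ j))) * Z j)
  factor j = cong (((+ 1) /ℕ (s C j)) *_) (trans
    (sumSubsets-cong s j (λ S₁ → cong (((+ 1) /ℕ (r C (k ∸ j))) *_)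
      (sumSubsets-cong r (k ∸ j) (λ S₂ → cong g (sym (elements-++ S₁ S₂))))))
    (sumSubsets-* s j ((+ 1) /ℕ (r C (k ∸ j)))
                  (λ S₁ → sumSubsets r (k ∸ j) (λ S₂ → g (elements (S₁ ++ᵥ S₂))))))
  cancel : ∀ j → hypergeometric s r (s ℕ.+ r) k j * meanOverSubsets s j (M j) ≡ 1/C * Z j
  cancel j = trans (cong (hypergeometric s r (s ℕ.+ r) k j *_) (factor j))
    (/ℕ-cancel (s C j) (r C (k ∸ j)) ((s ℕ.+ r) C k) (Z j)
      (sumSubsets-vanish s j)
      (λ C≡0 → sumSubsets-zero s j (λ S₁ → sumSubsets-vanish r (k ∸ j) C≡0)))

C-nonZero : ∀ {n k} → k ≤ n → NonZero (n C k)
C-nonZero k≤n = ℕ.>-nonZero (C-pos k≤n)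
  where
  C-pos : ∀ {n k} → k ≤ n → 0 < n C k
  C-pos {k = zero}  _ = s≤s z≤n
  C-pos {suc n} {suc k} (s≤s k≤n) =
    subst (0 <_) (nCk+nC[k+1]≡[n+1]C[k+1] n k) (ℕ.<-≤-trans (C-pos k≤n) (ℕ.m≤m+n _ _))

binomials-support : ∀ s r k j → (s C j) ℕ.* (r C (k ∸ j)) ≡ 0 ⊎ (j ≤ s × k ∸ j ≤ r)
binomials-support s r k j with j ℕ.≤? s | k ∸ j ℕ.≤? r
... | no j≰s   | _           = inj₁ (cong (ℕ._* (r C (k ∸ j))) (k>n⇒nCk≡0 (ℕ.≰⇒> j≰s)))
... | yes _    | no k∸j≰r    = inj₁ (trans (cong ((s C j) ℕ.*_) (k>n⇒nCk≡0 (ℕ.≰⇒> k∸j≰r))) (ℕ.*-zeroʳ (s C j)))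
... | yes j≤s  | yes k∸j≤r   = inj₂ (j≤s , k∸j≤r)

E-Sets-singleInterval : ∀ t (g : List ℕ → ℚ) →
  E (Sets (return ((1 , suc t) ∷ []))) g ≡ meanOverSubsets (suc t) 1 g
E-Sets-singleInterval t g = begin
  E (Sets (return ((1 , suc t) ∷ []))) g
    ≡⟨ E-Sets-return ((1 , suc t) ∷ []) g ⟩
  E (SetsF ((1 , suc t) ∷ [])) g
    ≡⟨ E-SetsF-∷ (1 , suc t) [] g ⟩
  E (uniformOn (1 , suc t)) (λ x → E (SetsF []) (g ∘ (x ∷_)))
    ≡⟨ E-cong (uniformOn (1 , suc t)) (λ x → E-return [] (g ∘ (x ∷_))) ⟩
  E (uniformOn (1 , suc t)) (λ x → g (x ∷ []))
    ≡⟨ E-uniformOn 1 (suc t) (λ x → g (x ∷ [])) ⟩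
  sumUpTo (suc t) (λ i → ((+ 1) / suc t) * g (suc i ∷ []))
    ≡⟨ sumUpTo-* (suc t) ((+ 1) / suc t) (λ i → g (suc i ∷ [])) ⟩
  ((+ 1) / suc t) * sumUpTo (suc t) (λ i → g (suc i ∷ []))
    ≡⟨ cong₂ _*_ (cong ((+ 1) /ℕ_) (sym (nC1≡n (suc t)))) (sym (sumSubsets-singletons (suc t) 0 g)) ⟩
  meanOverSubsets (suc t) 1 g ∎

sampleGo-uniform : ∀ fuel t k → t ≤ fuel → k ≤ t → ∀ (g : List ℕ → ℚ) →
  E (Sets (sampleGo fuel t k)) g ≡ meanOverSubsets t k g
sampleGo-uniform fuel t zero _ _ g = begin
  E (Sets (return [])) g         ≡⟨ E-Sets-return [] g ⟩
  E (return []) g                ≡⟨ E-return [] g ⟩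
  g []                           ≡⟨ cong g (elementsFrom-⊥ 0 t) ⟨
  g (elements (⊥ {t}))           ≡⟨ sumSubsets-⊥ t (g ∘ elements) ⟨
  sumSubsets t 0 (g ∘ elements)  ≡⟨ *-identityˡ (sumSubsets t 0 (g ∘ elements)) ⟨
  meanOverSubsets t 0 g          ∎
sampleGo-uniform fuel (suc t) (suc zero) _ _ g = E-Sets-singleInterval t g
sampleGo-uniform zero (suc (suc t)) (suc (suc k)) () _ g
sampleGo-uniform (suc fuel) (suc zero) (suc (suc k)) _ (s≤s ()) g
sampleGo-uniform (suc fuel) t@(suc (suc t′)) k@(suc (suc k′)) t≤1+fuel _ g = begin
  E (Sets (pickJ >>= A)) g
    ≡⟨ trans (E-bind (pickJ >>= A) SetsF g) (E-bind pickJ A Φ) ⟩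
  E pickJ (λ j → E (A j) Φ)
    ≡⟨ E-map-applyUpTo (λ j → (W j , j)) id (suc k) (λ j → E (A j) Φ) ⟩
  sumUpTo (suc k) (λ j → W j * E (A j) Φ)
    ≡⟨ sumUpTo-cong (suc k) recurse ⟩
  sumUpTo (suc k) (λ j → W j * meanOverSubsets s j (λ xs → meanOverSubsets r (k ∸ j) (G xs)))
    ≡⟨ meanOverSubsets-split s r t k (ℕ.m+[n∸m]≡n (ℕ.⌈n/2⌉≤n t)) g ⟩
  meanOverSubsets t k g ∎
  where
  s = ⌈ t /2⌉
  r = t ∸ s
  W = hypergeometric s r t k
  pickJ = map (λ j → (W j , j)) (upTo (suc k))
  A : ℕ → Dist IntervalSystem
  A j = sampleGo fuel s j >>= λ F₁ → sampleGo fuel r (k ∸ j) >>= λ F₂ → return (F₁ ++ shift s F₂)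
  Φ : IntervalSystem → ℚ
  Φ F = E (SetsF F) g
  G : List ℕ → List ℕ → ℚ
  G xs ys = g (xs ++ map (ℕ._+ s) ys)
  s≤fuel : s ≤ fuel
  s≤fuel = ℕ.≤-pred (ℕ.<-≤-trans (ℕ.⌈n/2⌉<n t′) t≤1+fuel)
  r≤fuel : r ≤ fuel
  r≤fuel = ℕ.≤-trans (ℕ.m∸n≤m (suc t′) ⌊ suc t′ /2⌋) (ℕ.≤-pred t≤1+fuel)
  recurse : ∀ j → W j * E (A j) Φ ≡ W j * meanOverSubsets s j (λ xs → meanOverSubsets r (k ∸ j) (G xs))
  recurse j with binomials-support s r k j
  ... | inj₁ C≡0 = w≡0⇒w*x≡w*y _ _ (trans (cong (λ n → (+ n) /ℕ (t C k)) C≡0) (0/ℕ≡0 (t C k)))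
  ... | inj₂ (j≤s , k∸j≤r) = cong (W j *_) (begin
    E (A j) Φ
      ≡⟨ E-bind (A j) SetsF g ⟨
    E (Sets (A j)) g
      ≡⟨ E-Sets-juxtapose (sampleGo fuel s j) (sampleGo fuel r (k ∸ j)) s g ⟩
    E (Sets (sampleGo fuel s j)) (λ xs → E (Sets (sampleGo fuel r (k ∸ j))) (G xs))
      ≡⟨ E-cong (Sets (sampleGo fuel s j)) (λ xs → sampleGo-uniform fuel r (k ∸ j) r≤fuel k∸j≤r (G xs)) ⟩
    E (Sets (sampleGo fuel s j)) (λ xs → meanOverSubsets r (k ∸ j) (G xs))
      ≡⟨ sampleGo-uniform fuel s j s≤fuel j≤s _ ⟩
    meanOverSubsets s j (λ xs → meanOverSubsets r (k ∸ j) (G xs)) ∎)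

claim3p8 : (t k : ℕ) → 1 ≤ t → k ≤ t →
    (mass (Sets (𝓕 t k)) ≡ 1ℚ) ×
    ((S : Subset t) →
      Pr (Sets (𝓕 t k)) (isSet t S) ≡ (if ∣ S ∣ ≡ᵇ k then (+ 1) /ℕ (t C k) else 0ℚ))
claim3p8 t k _ k≤t = total-mass , probability
  where
  uniform : ∀ g → E (Sets (𝓕 t k)) g ≡ meanOverSubsets t k g
  uniform = sampleGo-uniform t t k ℕ.≤-refl k≤t
  total-mass : mass (Sets (𝓕 t k)) ≡ 1ℚ
  total-mass = begin
    mass (Sets (𝓕 t k))                           ≡⟨ mass≡E (Sets (𝓕 t k)) ⟩
    E (Sets (𝓕 t k)) (const 1ℚ)                   ≡⟨ uniform (const 1ℚ) ⟩
    ((+ 1) /ℕ (t C k)) * sumSubsets t k (const 1ℚ)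
      ≡⟨ cong (((+ 1) /ℕ (t C k)) *_) (sumSubsets-const-1 t k) ⟩
    ((+ 1) /ℕ (t C k)) * ι (t C k)                 ≡⟨ /ℕ-inverseˡ (t C k) {{C-nonZero k≤t}} ⟩
    1ℚ                                             ∎
  probability : ∀ S → Pr (Sets (𝓕 t k)) (isSet t S) ≡ (if ∣ S ∣ ≡ᵇ k then (+ 1) /ℕ (t C k) else 0ℚ)
  probability S = begin
    Pr (Sets (𝓕 t k)) (isSet t S)     ≡⟨ Pr≡E (Sets (𝓕 t k)) (isSet t S) ⟩
    E (Sets (𝓕 t k)) (𝟙 ∘ isSet t S) ≡⟨ uniform (𝟙 ∘ isSet t S) ⟩
    ((+ 1) /ℕ (t C k)) * sumSubsets t k (𝟙 ∘ isSet t S ∘ elements)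
      ≡⟨ cong (((+ 1) /ℕ (t C k)) *_) (sumSubsets-isSet t k S) ⟩
    ((+ 1) /ℕ (t C k)) * 𝟙 (∣ S ∣ ≡ᵇ k)
      ≡⟨ *-𝟙 ((+ 1) /ℕ (t C k)) (∣ S ∣ ≡ᵇ k) ⟩
    (if ∣ S ∣ ≡ᵇ k then (+ 1) /ℕ (t C k) else 0ℚ) ∎
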